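{- For each integer $u\geq 1$, there is a $2$-dimensional poset $R_u$ of width $u$ together with a realizer $L_x, L_y$ of $R_u$ such that the following holds: if $L$ is any linear extension of $R_u$, and $d_x$ (respectively $d_y$) denotes the maximum size of a set of elements of $R_u$ that are increasing in $L$ and decreasing in $L_x$ (respectively decreasing in $L_y$), then $d_x + d_y \geq u+1$.
   Context: A poset $P=(X,<)$ is a finite set with a transitive, antisymmetric strict order relation. Its width is the maximum number of pairwise incomparable elements. A linear extension of $P$ is a total order $L$ on $X$ such that $a<b$ in $P$ implies $a<b$ in $L$. A poset is $2$-dimensional if there are two linear extensions $L_1, L_2$ (called a realizer) such that $x<y$ in $P$ if and only if $x<y$ in both $L_1$ and $L_2$. A set of elements is "increasing in $L$ and decreasing in $L_x$" if its elements appear in one order in $L$ and in exactly the reverse order in $L_x$. -}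

module Defs where

open import Level using (0ℓ)
open import Data.Nat using (ℕ; _≤_; _<_)
open import Data.Fin using (Fin) renaming (_<_ to _<ᶠ_)
open import Data.List using (List; length)
open import Data.List.Relation.Unary.AllPairs using (AllPairs)
open import Data.List.Relation.Unary.Unique.Propositional using (Unique)
open import Data.Product using (_×_)
open import Relation.Nullary using (¬_)
open import Function.Definitions using (Injective)
open import Relation.Binary.PropositionalEquality using (_≡_)

record Poset (n : ℕ) : Set₁ where
  field
    _≺_   : Fin n → Fin n → Set
    irrefl : ∀ a → ¬ (a ≺ a)
    trans  : ∀ {a b c} → a ≺ b → b ≺ c → a ≺ c
    asym   : ∀ {a b} → a ≺ b → ¬ (b ≺ a)
open Poset public

-- A total order on Fin n, given by the position of each element
-- (an injective, hence bijective, map Fin n → Fin n).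
-- a comes before b in L iff pos L a < pos L b.
record LinOrder (n : ℕ) : Set where
  field
    pos    : Fin n → Fin n
    pos-inj : Injective _≡_ _≡_ pos
open LinOrder public

_<[_]_ : ∀ {n} → Fin n → LinOrder n → Fin n → Set
a <[ L ] b = pos L a <ᶠ pos L b

IsLinExt : ∀ {n} → Poset n → LinOrder n → Set
IsLinExt P L = ∀ a b → _≺_ P a b → a <[ L ] b

IsRealizer : ∀ {n} → Poset n → LinOrder n → LinOrder n → Set
IsRealizer P L₁ L₂ =
  IsLinExt P L₁ × IsLinExt P L₂ ×
  (∀ a b → (a <[ L₁ ] b × a <[ L₂ ] b) → _≺_ P a b)

-- Sets of elements are represented by duplicate-free lists; size = length.
-- "S is a maximum-size set with property Q": Q holds of S-like sets of size m,
-- and every such set has size ≤ m.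
IsMaxSize : ∀ {n} → (List (Fin n) → Set) → ℕ → Set
IsMaxSize {n} Q m =
  (Data.Product.Σ (List (Fin n)) λ S → Unique S × Q S × length S ≡ m) ×
  (∀ S → Unique S → Q S → length S ≤ m)

Incomparable : ∀ {n} → Poset n → Fin n → Fin n → Set
Incomparable P a b = ¬ (_≺_ P a b) × ¬ (_≺_ P b a)

IsAntichain : ∀ {n} → Poset n → List (Fin n) → Set
IsAntichain P S = AllPairs (Incomparable P) S

Width : ∀ {n} → Poset n → ℕ → Set
Width P w = IsMaxSize (IsAntichain P) w

Reversed : ∀ {n} → LinOrder n → LinOrder n → Fin n → Fin n → Set
Reversed L L' a b = (a <[ L ] b → b <[ L' ] a) × (b <[ L ] a → a <[ L' ] b)

IncDec : ∀ {n} → LinOrder n → LinOrder n → List (Fin n) → Set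
IncDec L L' S = AllPairs (Reversed L L') S

-- R₀ is a point and R_{k+1} consists of a pivot p, first in Lx and last in
-- Ly, together with two copies A and B of R_k, A lying below B in both
-- orders. Given a linear extension L, take the sets S_A, T_A and S_B, T_B
-- given by induction. If every element of S_A precedes p in L, then p can be
-- prepended to S_A. Otherwise some a ∈ S_A follows p in L; since a lies below
-- all of B, so does p, and p can be prepended to T_B. Either way the total
-- grows by one. The width is k + 1: the pivots of the successive copies of A
-- form an antichain, and the elements of equal depth in the recursion form a
-- chain.
module Submission where

open import Defs hiding (trans)
open import Data.Nat using (ℕ; _≤_; _+_; suc)
open import Data.Product using (Σ; _×_)

open import Data.Nat as ℕ using (zero; z<s; s≤s)
import Data.Nat.Properties as ℕ
open import Data.Fin as Fin using (Fin; toℕ; _↑ˡ_; _↑ʳ_; splitAt; join; inject₁; fromℕ)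
import Data.Fin.Properties as Fin
open import Data.Sum as Sum using (_⊎_; inj₁; inj₂)
import Data.Sum.Properties as Sum
open import Data.Product as Product using (_,_; proj₁; proj₂)
open import Data.List using (List; []; _∷_; map; length; lookup)
open import Data.List.Properties using (length-map)
open import Data.List.Membership.Propositional.Properties using (∈-lookup)
open import Data.List.Relation.Unary.All as All using (All; []; _∷_)
import Data.List.Relation.Unary.All.Properties as All
open import Data.List.Relation.Unary.Any using (satisfied)
open import Data.List.Relation.Unary.AllPairs as AllPairs using (AllPairs; []; _∷_)
import Data.List.Relation.Unary.AllPairs.Properties as AllPairs
open import Data.List.Relation.Unary.Unique.Propositional using (Unique)
import Data.List.Relation.Unary.Unique.Propositional.Properties as Unique
open import Function using (_∘_; id)
open import Function.Definitions using (Injective)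
open import Relation.Nullary using (¬_; Dec; yes; no; contradiction)
open import Relation.Binary.PropositionalEquality

private
  variable
    n n′ m m′ M : ℕ

intersection : LinOrder n → LinOrder n → Poset n
intersection L₁ L₂ = record
  { _≺_    = λ a b → a <[ L₁ ] b × a <[ L₂ ] b
  ; irrefl = λ a (p , _) → Fin.<-irrefl refl p
  ; trans  = Product.zip Fin.<-trans Fin.<-trans
  ; asym   = λ (p , _) (q , _) → Fin.<-asym p q
  }

intersection-isRealizer : (L₁ L₂ : LinOrder n) → IsRealizer (intersection L₁ L₂) L₁ L₂
intersection-isRealizer L₁ L₂ = (λ _ _ → proj₁) , (λ _ _ → proj₂) , (λ _ _ p → p)

-- Reversed L L′ is Reversedᶠ (pos L) (pos L′); the first map need not be a
-- bijection, so that it can be restricted to a copy of a smaller poset.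
Reversedᶠ : (Fin n → Fin m) → (Fin n → Fin m′) → Fin n → Fin n → Set
Reversedᶠ f g a b = (f a Fin.< f b → g b Fin.< g a) × (f b Fin.< f a → g a Fin.< g b)

IncDecᶠ : (Fin n → Fin m) → (Fin n → Fin m′) → List (Fin n) → Set
IncDecᶠ f g = AllPairs (Reversedᶠ f g)

reversed-intro : {f : Fin n → Fin m} {g : Fin n → Fin m′} {a b : Fin n} →
                 f b Fin.< f a → g a Fin.< g b → Reversedᶠ f g a b
reversed-intro fb<fa ga<gb = (λ fa<fb → contradiction fb<fa (Fin.<-asym fa<fb)) , (λ _ → ga<gb)

incDec-map : (e : Fin n → Fin n′) {f : Fin n′ → Fin M} {g : Fin n → Fin m} {g′ : Fin n′ → Fin m′} →
             (∀ {a b} → g a Fin.< g b → g′ (e a) Fin.< g′ (e b)) →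
             ∀ {S} → IncDecᶠ (f ∘ e) g S → IncDecᶠ f g′ (map e S)
incDec-map e mono = AllPairs.map⁺ ∘ AllPairs.map (Product.map (mono ∘_) (mono ∘_))

lookup-injective : {xs : List (Fin n)} → Unique xs → Injective _≡_ _≡_ (lookup xs)
lookup-injective (_   ∷ _)   {Fin.zero}  {Fin.zero}  _  = refl
lookup-injective (x∉ ∷ _)   {Fin.zero}  {Fin.suc j} eq = contradiction eq (All.lookup x∉ (∈-lookup j))
lookup-injective (x∉ ∷ _)   {Fin.suc i} {Fin.zero}  eq = contradiction (sym eq) (All.lookup x∉ (∈-lookup i))
lookup-injective (_   ∷ xs!) {Fin.suc i} {Fin.suc j} eq = cong Fin.suc (lookup-injective xs! eq)

unique-length≤ : {xs : List (Fin n)} → Unique xs → length xs ≤ n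
unique-length≤ xs! = Fin.injective⇒≤ (lookup-injective xs!)

-- The easy direction of Dilworth's theorem: c assigns each element one of m chains.
antichain-length≤ : (P : Poset n) (c : Fin n → Fin m) →
                    (∀ a b → a ≢ b → c a ≡ c b → _≺_ P a b ⊎ _≺_ P b a) →
                    ∀ S → Unique S → IsAntichain P S → length S ≤ m
antichain-length≤ {m = m} P c chain S S! anti =
  subst (_≤ m) (length-map c S)
        (unique-length≤ (AllPairs.map⁺ (AllPairs.zipWith separated (S! , anti))))
  where
  separated : ∀ {a b} → a ≢ b × Incomparable P a b → c a ≢ c b
  separated {a} {b} (a≢b , a⊀b , b⊀a) ca≡cb = Sum.[ a⊀b , b⊀a ] (chain a b a≢b ca≡cb)

size : ℕ → ℕ
size zero    = 1
size (suc k) = suc (size k + size k)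

pivot : ∀ k → Fin (size (suc k))
pivot k = Fin.zero

lower upper : ∀ k → Fin (size k) → Fin (size (suc k))
lower k i = Fin.suc (i ↑ˡ size k)
upper k j = Fin.suc (size k ↑ʳ j)

lower-injective : ∀ k → Injective _≡_ _≡_ (lower k)
lower-injective k = Fin.↑ˡ-injective (size k) _ _ ∘ Fin.suc-injective

upper-injective : ∀ k → Injective _≡_ _≡_ (upper k)
upper-injective k = Fin.↑ʳ-injective (size k) _ _ ∘ Fin.suc-injective

data Part k : Fin (size (suc k)) → Set where
  is-pivot : Part k (pivot k)
  is-lower : ∀ i → Part k (lower k i)
  is-upper : ∀ j → Part k (upper k j)

part : ∀ k x → Part k x
part k Fin.zero    = is-pivot
part k (Fin.suc x) with splitAt (size k) x in eq
... | inj₁ i = subst (Part k) (cong Fin.suc (Fin.splitAt⁻¹-↑ˡ eq)) (is-lower i)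
... | inj₂ j = subst (Part k) (cong Fin.suc (Fin.splitAt⁻¹-↑ʳ eq)) (is-upper j)

-- Lx is the identity: pivot, lower copy, upper copy. Ly lists the lower
-- copy, then the upper copy (each ordered by its own Ly), then the pivot.
posY : ∀ k → Fin (size k) → Fin (size k)
posY zero    x           = x
posY (suc k) Fin.zero    = fromℕ (size k + size k)
posY (suc k) (Fin.suc x) = inject₁ (join (size k) (size k) (Sum.map (posY k) (posY k) (splitAt (size k) x)))

posY-injective : ∀ k → Injective _≡_ _≡_ (posY k)
posY-injective zero    eq = eq
posY-injective (suc k) {Fin.zero}  {Fin.zero}  _  = refl
posY-injective (suc k) {Fin.zero}  {Fin.suc _} eq = contradiction eq Fin.fromℕ≢inject₁
posY-injective (suc k) {Fin.suc _} {Fin.zero}  eq = contradiction (sym eq) Fin.fromℕ≢inject₁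
posY-injective (suc k) {Fin.suc x} {Fin.suc y} eq =
  cong Fin.suc (splitAt-injective (map-injective (join-injective (Fin.inject₁-injective eq))))
  where
  N = size k
  join-injective : Injective _≡_ _≡_ (join N N)
  join-injective {u} {v} e = trans (sym (Fin.splitAt-join N N u)) (trans (cong (splitAt N) e) (Fin.splitAt-join N N v))
  splitAt-injective : Injective _≡_ _≡_ (splitAt N {N})
  splitAt-injective {u} {v} e = trans (sym (Fin.join-splitAt N N u)) (trans (cong (join N N) e) (Fin.join-splitAt N N v))
  map-injective : Injective _≡_ _≡_ (Sum.map (posY k) (posY k))
  map-injective {inj₁ _} {inj₁ _} e = cong inj₁ (posY-injective k (Sum.inj₁-injective e))
  map-injective {inj₂ _} {inj₂ _} e = cong inj₂ (posY-injective k (Sum.inj₂-injective e))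
  map-injective {inj₁ _} {inj₂ _} ()
  map-injective {inj₂ _} {inj₁ _} ()

Lx Ly : ∀ k → LinOrder (size k)
Lx k = record { pos = id ; pos-inj = id }
Ly k = record { pos = posY k ; pos-inj = posY-injective k }

R : ∀ k → Poset (size k)
R k = intersection (Lx k) (Ly k)

Below : ∀ k → Fin (size k) → Fin (size k) → Set
Below k = _≺_ (R k)

syntax Below k a b = a ≺⟨ k ⟩ b

Y : ∀ k → Fin (size k) → ℕ
Y k = toℕ ∘ posY k

toℕ-lower : ∀ k i → toℕ (lower k i) ≡ suc (toℕ i)
toℕ-lower k i = cong suc (Fin.toℕ-↑ˡ i (size k))

toℕ-upper : ∀ k j → toℕ (upper k j) ≡ suc (size k + toℕ j)
toℕ-upper k j = cong suc (Fin.toℕ-↑ʳ (size k) j)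

Y-lower : ∀ k i → Y (suc k) (lower k i) ≡ Y k i
Y-lower k i rewrite Fin.splitAt-↑ˡ (size k) i (size k) =
  trans (Fin.toℕ-inject₁ (posY k i ↑ˡ size k)) (Fin.toℕ-↑ˡ (posY k i) (size k))

Y-upper : ∀ k j → Y (suc k) (upper k j) ≡ size k + Y k j
Y-upper k j rewrite Fin.splitAt-↑ʳ (size k) (size k) j =
  trans (Fin.toℕ-inject₁ (size k ↑ʳ posY k j)) (Fin.toℕ-↑ʳ (size k) (posY k j))

Y-pivot : ∀ k → Y (suc k) (pivot k) ≡ size k + size k
Y-pivot k = Fin.toℕ-fromℕ (size k + size k)

Y<size : ∀ k a → Y k a ℕ.< size k
Y<size k a = Fin.toℕ<n (posY k a)

lower-monoˣ : ∀ k {a b} → a Fin.< b → lower k a Fin.< lower k b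
lower-monoˣ k {a} {b} a<b rewrite toℕ-lower k a | toℕ-lower k b = s≤s a<b

lower-monoʸ : ∀ k {a b} → Y k a ℕ.< Y k b → Y (suc k) (lower k a) ℕ.< Y (suc k) (lower k b)
lower-monoʸ k {a} {b} a<b rewrite Y-lower k a | Y-lower k b = a<b

upper-monoˣ : ∀ k {a b} → a Fin.< b → upper k a Fin.< upper k b
upper-monoˣ k {a} {b} a<b rewrite toℕ-upper k a | toℕ-upper k b = s≤s (ℕ.+-monoʳ-< (size k) a<b)

upper-monoʸ : ∀ k {a b} → Y k a ℕ.< Y k b → Y (suc k) (upper k a) ℕ.< Y (suc k) (upper k b)
upper-monoʸ k {a} {b} a<b rewrite Y-upper k a | Y-upper k b = ℕ.+-monoʳ-< (size k) a<b

lower-≺ : ∀ k {a b} → a ≺⟨ k ⟩ b → lower k a ≺⟨ suc k ⟩ lower k b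
lower-≺ k = Product.map (lower-monoˣ k) (lower-monoʸ k)

lower-≺⁻ : ∀ k {a b} → lower k a ≺⟨ suc k ⟩ lower k b → a ≺⟨ k ⟩ b
lower-≺⁻ k {a} {b} (p , q) rewrite toℕ-lower k a | toℕ-lower k b | Y-lower k a | Y-lower k b =
  ℕ.≤-pred p , q

upper-≺ : ∀ k {a b} → a ≺⟨ k ⟩ b → upper k a ≺⟨ suc k ⟩ upper k b
upper-≺ k = Product.map (upper-monoˣ k) (upper-monoʸ k)

lower≺upper : ∀ k i j → lower k i ≺⟨ suc k ⟩ upper k j
lower≺upper k i j rewrite toℕ-lower k i | toℕ-upper k j | Y-lower k i | Y-upper k j =
  s≤s (ℕ.<-≤-trans (Fin.toℕ<n i) (ℕ.m≤m+n (size k) _)) , ℕ.<-≤-trans (Y<size k i) (ℕ.m≤m+n (size k) _)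

upper<ʸpivot : ∀ k j → Y (suc k) (upper k j) ℕ.< Y (suc k) (pivot k)
upper<ʸpivot k j rewrite Y-upper k j | Y-pivot k = ℕ.+-monoʳ-< (size k) (Y<size k j)

lower⊀pivot : ∀ k i → ¬ (lower k i ≺⟨ suc k ⟩ pivot k)
lower⊀pivot k i (p , _) = contradiction p λ ()

pivot⊀lower : ∀ k i → ¬ (pivot k ≺⟨ suc k ⟩ lower k i)
pivot⊀lower k i (_ , q) rewrite Y-lower k i | Y-pivot k =
  ℕ.<-asym q (ℕ.<-≤-trans (Y<size k i) (ℕ.m≤m+n (size k) _))

record ReversalPair k (f : Fin (size k) → Fin M) : Set where
  field
    S T      : List (Fin (size k))
    S-unique : Unique S
    T-unique : Unique T
    S-incDec : IncDecᶠ f id S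
    T-incDec : IncDecᶠ f (posY k) T
    bound    : 2 + k ≤ length S + length T

extend-S : ∀ k {f : Fin (size (suc k)) → Fin M} (P : ReversalPair k (f ∘ lower k)) →
           All (λ a → f (lower k a) Fin.< f (pivot k)) (ReversalPair.S P) → ReversalPair (suc k) f
extend-S k {f = f} P before = record
  { S        = pivot k ∷ map (lower k) S
  ; T        = map (lower k) T
  ; S-unique = All.map⁺ (All.universal (λ _ ()) S) ∷ Unique.map⁺ (lower-injective k) S-unique
  ; T-unique = Unique.map⁺ (lower-injective k) T-unique
  ; S-incDec = All.map⁺ (All.map (λ a<p → reversed-intro {f = f} {g = id} a<p z<s) before)
             ∷ incDec-map (lower k) (lower-monoˣ k) S-incDec
  ; T-incDec = incDec-map (lower k) (lower-monoʸ k) T-incDec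
  ; bound    = subst (3 + k ≤_)
                     (sym (cong₂ (λ s t → suc s + t) (length-map (lower k) S) (length-map (lower k) T)))
                     (s≤s bound)
  }
  where open ReversalPair P

extend-T : ∀ k {f : Fin (size (suc k)) → Fin M} (P : ReversalPair k (f ∘ upper k)) →
           (∀ b → f (pivot k) Fin.< f (upper k b)) → ReversalPair (suc k) f
extend-T k {f = f} P after = record
  { S        = map (upper k) S
  ; T        = pivot k ∷ map (upper k) T
  ; S-unique = Unique.map⁺ (upper-injective k) S-unique
  ; T-unique = All.map⁺ (All.universal (λ _ ()) T) ∷ Unique.map⁺ (upper-injective k) T-unique
  ; S-incDec = incDec-map (upper k) (upper-monoˣ k) S-incDec
  ; T-incDec = All.map⁺ (All.universal pivot-reversed T)
             ∷ incDec-map (upper k) (upper-monoʸ k) T-incDec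
  ; bound    = subst (3 + k ≤_)
                     (sym (trans (cong₂ (λ s t → s + suc t) (length-map (upper k) S) (length-map (upper k) T))
                                 (ℕ.+-suc (length S) (length T))))
                     (s≤s bound)
  }
  where
  open ReversalPair P
  pivot-reversed : ∀ b → Reversedᶠ f (posY (suc k)) (pivot k) (upper k b)
  pivot-reversed b = Product.swap (reversed-intro {f = f} {g = posY (suc k)} (after b) (upper<ʸpivot k b))

reversalPair : ∀ k (f : Fin (size k) → Fin M) → (∀ a b → a ≺⟨ k ⟩ b → f a Fin.< f b) → ReversalPair k f
reversalPair zero f _ = record
  { S = Fin.zero ∷ [] ; T = Fin.zero ∷ []
  ; S-unique = [] ∷ [] ; T-unique = [] ∷ []
  ; S-incDec = [] ∷ [] ; T-incDec = [] ∷ []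
  ; bound = ℕ.≤-refl
  }
reversalPair (suc k) f mono = extend (All.all? precedesPivot? (ReversalPair.S A))
  where
  A = reversalPair k (f ∘ lower k) (λ a b → mono _ _ ∘ lower-≺ k)
  B = reversalPair k (f ∘ upper k) (λ a b → mono _ _ ∘ upper-≺ k)
  precedesPivot? : ∀ a → Dec (f (lower k a) Fin.< f (pivot k))
  precedesPivot? a = f (lower k a) Fin.<? f (pivot k)
  extend : Dec (All (λ a → f (lower k a) Fin.< f (pivot k)) (ReversalPair.S A)) → ReversalPair (suc k) f
  extend (yes before) = extend-S k A before
  extend (no ¬before) = extend-T k B after
    where
    -- some a ∈ S_A does not precede the pivot, and a lies below all of the upper copy
    after : ∀ b → f (pivot k) Fin.< f (upper k b)
    after b with a , a≮p ← satisfied (All.¬All⇒Any¬ precedesPivot? _ ¬before) =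
      ℕ.≤-<-trans (ℕ.≮⇒≥ a≮p) (mono _ _ (lower≺upper k a b))

depth : ∀ k → Fin (size k) → Fin (suc k)
depth zero    _           = Fin.zero
depth (suc k) Fin.zero    = Fin.zero
depth (suc k) (Fin.suc x) = Fin.suc (Sum.[ depth k , depth k ]′ (splitAt (size k) x))

depth-lower : ∀ k i → depth (suc k) (lower k i) ≡ Fin.suc (depth k i)
depth-lower k i rewrite Fin.splitAt-↑ˡ (size k) i (size k) = refl

depth-upper : ∀ k j → depth (suc k) (upper k j) ≡ Fin.suc (depth k j)
depth-upper k j rewrite Fin.splitAt-↑ʳ (size k) (size k) j = refl

sameDepth⇒comparable : ∀ k a b → a ≢ b → depth k a ≡ depth k b → a ≺⟨ k ⟩ b ⊎ b ≺⟨ k ⟩ a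
sameDepth⇒comparable zero Fin.zero Fin.zero a≢b _ = contradiction refl a≢b
sameDepth⇒comparable (suc k) a b a≢b eq with part k a | part k b
... | is-pivot   | is-pivot   = contradiction refl a≢b
... | is-pivot   | is-lower i = contradiction (trans eq (depth-lower k i)) λ ()
... | is-pivot   | is-upper j = contradiction (trans eq (depth-upper k j)) λ ()
... | is-lower i | is-pivot   = contradiction (trans (sym eq) (depth-lower k i)) λ ()
... | is-upper j | is-pivot   = contradiction (trans (sym eq) (depth-upper k j)) λ ()
... | is-lower i | is-upper j = inj₁ (lower≺upper k i j)
... | is-upper j | is-lower i = inj₂ (lower≺upper k i j)
... | is-lower i | is-lower i′ =
  Sum.map (lower-≺ k) (lower-≺ k)
    (sameDepth⇒comparable k i i′ (a≢b ∘ cong (lower k))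
      (Fin.suc-injective (trans (sym (depth-lower k i)) (trans eq (depth-lower k i′)))))
... | is-upper j | is-upper j′ =
  Sum.map (upper-≺ k) (upper-≺ k)
    (sameDepth⇒comparable k j j′ (a≢b ∘ cong (upper k))
      (Fin.suc-injective (trans (sym (depth-upper k j)) (trans eq (depth-upper k j′)))))

pivots : ∀ k → List (Fin (size k))
pivots zero    = Fin.zero ∷ []
pivots (suc k) = pivot k ∷ map (lower k) (pivots k)

pivots-length : ∀ k → length (pivots k) ≡ suc k
pivots-length zero    = refl
pivots-length (suc k) = cong suc (trans (length-map (lower k) (pivots k)) (pivots-length k))

pivots-unique : ∀ k → Unique (pivots k)
pivots-unique zero    = [] ∷ []
pivots-unique (suc k) =
  All.map⁺ (All.universal (λ _ ()) (pivots k))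
  ∷ Unique.map⁺ (lower-injective k) (pivots-unique k)

pivots-antichain : ∀ k → IsAntichain (R k) (pivots k)
pivots-antichain zero    = [] ∷ []
pivots-antichain (suc k) =
  All.map⁺ (All.universal (λ i → pivot⊀lower k i , lower⊀pivot k i) (pivots k))
  ∷ AllPairs.map⁺ (AllPairs.map (Product.map (_∘ lower-≺⁻ k) (_∘ lower-≺⁻ k)) (pivots-antichain k))

width : ∀ k → Width (R k) (suc k)
width k = (pivots k , pivots-unique k , pivots-antichain k , pivots-length k)
        , antichain-length≤ (R k) (depth k) (sameDepth⇒comparable k)

lemma1 : ∀ (u : ℕ) → 1 ≤ u →
    Σ ℕ λ n → Σ (Poset n) λ R → Σ (LinOrder n) λ Lx → Σ (LinOrder n) λ Ly →
      Width R u × IsRealizer R Lx Ly ×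
      (∀ (L : LinOrder n) → IsLinExt R L → ∀ (dx dy : ℕ) →
        IsMaxSize (IncDec L Lx) dx → IsMaxSize (IncDec L Ly) dy →
        suc u ≤ dx + dy)
lemma1 (suc k) _ =
  size k , R k , Lx k , Ly k , width k , intersection-isRealizer (Lx k) (Ly k) ,
  λ L L-ext dx dy (_ , dx-max) (_ , dy-max) →
    let open ReversalPair (reversalPair k (pos L) L-ext)
    in ℕ.≤-trans bound (ℕ.+-mono-≤ (dx-max S S-unique S-incDec) (dy-max T T-unique T-incDec))
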